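{- For $n\geq 0$ let $$L_{n;1}^{(I)}(x) = \sum_{k=0}^{n} \binom{n}{k}^2 \left( - 3 H_k + 2 H_{n-k} \right) \frac{x^k}{k!}, \qquad L_{n;2}^{(I)}(x) = \sum_{k=0}^{n} \binom{n}{k}^2 \frac{x^k}{k!},$$ where $H_l=\sum_{j=1}^l 1/j$. Then $n!\, \mathrm{lcm}(1,\dots,n)\, L_{n;1}^{(I)}(x)\in\mathbb{Z}[x]$ and $n!\, L_{n;2}^{(I)}(x) \in\mathbb{Z}[x]$.
   Context: $\mathrm{lcm}(1,\dots,n)$ is the least common multiple of $1,\dots,n$ (equal to $1$ for $n=0$). -}

module Defs where

open import Data.Nat as ℕ using (ℕ; zero; suc; _!)
open import Data.Nat.LCM using (lcm)
open import Data.Nat.Combinatorics using (_C_)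
open import Data.Nat.Properties using (_!≢0)
open import Data.Integer as ℤ using (ℤ; +_)
open import Data.Rational using (ℚ; _/_; _+_; _*_; _-_; 0ℚ)
open import Data.List using (List; map; upTo)
open import Data.List.Relation.Unary.All using (All)
open import Data.Product using (∃)
open import Relation.Binary.PropositionalEquality using (_≡_)

H : ℕ → ℚ
H zero = 0ℚ
H (suc l) = H l + (+ 1 / suc l)

lcmUpTo : ℕ → ℕ
lcmUpTo zero = 1
lcmUpTo (suc n) = lcm (suc n) (lcmUpTo n)

ℕ→ℚ : ℕ → ℚ
ℕ→ℚ m = + m / 1

inv! : ℕ → ℚ
inv! k = (+ 1 / (k !)) {{k !≢0}}

-- A polynomial with rational coefficients, given by its coefficient list
-- [a₀, a₁, …, a_n] (a_k is the coefficient of x^k).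
Poly : Set
Poly = List ℚ

_·_ : ℚ → Poly → Poly
c · p = map (c *_) p

InZx : Poly → Set
InZx p = All (λ q → ∃ λ (z : ℤ) → q ≡ z / 1) p

L1 : ℕ → Poly
L1 n = map (λ k → ℕ→ℚ ((n C k) ℕ.* (n C k))
                   * ((ℕ→ℚ 2 * H (n ℕ.∸ k)) - ℕ→ℚ 3 * H k)
                   * inv! k)
           (upTo (suc n))

L2 : ℕ → Poly
L2 n = map (λ k → ℕ→ℚ ((n C k) ℕ.* (n C k)) * inv! k) (upTo (suc n))

{-# OPTIONS --safe #-}
-- Since k! ∣ n!, multiplying by n! turns C(n,k)² / k! into the integer
-- (n!/k!) C(n,k)².  Since every j ≤ l ≤ n divides lcm(1,…,n), multiplying by
-- lcm(1,…,n) turns the harmonic number H_l into an integer, so the extra factor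
-- -3 H_k + 2 H_{n-k} of L₁ costs exactly one factor lcm(1,…,n).
module Submission where

open import Defs
open import Data.Nat as ℕ using (ℕ; zero; suc; _*_; _∸_; _!; _≤_; NonZero; ≤′-refl; ≤′-step)
open import Data.Nat.Properties using (≤⇒≤′; m∸n≤m; _!≢0)
open import Data.Nat.Divisibility using (_∣_; divides; ∣-refl; ∣-trans; m≤n⇒m!∣n!)
open import Data.Nat.LCM using (m∣lcm[m,n]; n∣lcm[m,n])
open import Data.Nat.Combinatorics using (_C_)
open import Data.Integer as ℤ using (ℤ; +_)
import Data.Integer.Properties as ℤ
open import Data.Rational as ℚ using (ℚ; _/_; _+_; _-_; -_; 1ℚ; toℚᵘ)
open import Data.Rational.Properties
  using (toℚᵘ-injective; toℚᵘ-fromℚᵘ; toℚᵘ-homo-+; toℚᵘ-homo-*; toℚᵘ-homo‿-;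
         *-zeroʳ; *-assoc; *-identityʳ; *-distribˡ-+; +-*-commutativeRing)
open import Data.Rational.Unnormalised as ℚᵘ using (mkℚᵘ; 1ℚᵘ)
import Data.Rational.Unnormalised.Properties as ℚᵘ
open import Data.List using (map; upTo)
open import Data.List.Relation.Unary.All.Properties using (map⁺; applyUpTo⁺₁)
open import Data.Product using (_×_; ∃; _,_)
open import Data.Maybe using (nothing)
open import Function using (id; _∘_)
open import Level using (0ℓ)
open import Relation.Binary.PropositionalEquality
  using (_≡_; refl; sym; trans; cong; cong₂; subst; module ≡-Reasoning)
open import Tactic.RingSolver using (solve-∀)
open import Tactic.RingSolver.Core.AlmostCommutativeRing using (AlmostCommutativeRing; fromCommutativeRing)

ℤ→ℚ : ℤ → ℚ
ℤ→ℚ z = z / 1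

IsInt : ℚ → Set
IsInt q = ∃ λ (z : ℤ) → q ≡ ℤ→ℚ z

toℚᵘ-ℤ→ℚ : ∀ z → toℚᵘ (ℤ→ℚ z) ℚᵘ.≃ mkℚᵘ z 0
toℚᵘ-ℤ→ℚ z = toℚᵘ-fromℚᵘ (mkℚᵘ z 0)

ℤ→ℚ-homo-+ : ∀ a b → ℤ→ℚ (a ℤ.+ b) ≡ ℤ→ℚ a + ℤ→ℚ b
ℤ→ℚ-homo-+ a b = toℚᵘ-injective (begin-equality
  toℚᵘ (ℤ→ℚ (a ℤ.+ b))            ≃⟨ toℚᵘ-ℤ→ℚ (a ℤ.+ b) ⟩
  mkℚᵘ (a ℤ.+ b) 0                ≡⟨ sym (cong₂ (λ x y → mkℚᵘ (x ℤ.+ y) 0) (ℤ.*-identityʳ a) (ℤ.*-identityʳ b)) ⟩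
  mkℚᵘ a 0 ℚᵘ.+ mkℚᵘ b 0          ≃⟨ ℚᵘ.≃-sym (ℚᵘ.+-cong (toℚᵘ-ℤ→ℚ a) (toℚᵘ-ℤ→ℚ b)) ⟩
  toℚᵘ (ℤ→ℚ a) ℚᵘ.+ toℚᵘ (ℤ→ℚ b)  ≃⟨ ℚᵘ.≃-sym (toℚᵘ-homo-+ (ℤ→ℚ a) (ℤ→ℚ b)) ⟩
  toℚᵘ (ℤ→ℚ a + ℤ→ℚ b)            ∎)
  where open ℚᵘ.≤-Reasoning

ℤ→ℚ-homo-* : ∀ a b → ℤ→ℚ (a ℤ.* b) ≡ ℤ→ℚ a ℚ.* ℤ→ℚ b
ℤ→ℚ-homo-* a b = toℚᵘ-injective (begin-equality
  toℚᵘ (ℤ→ℚ (a ℤ.* b))            ≃⟨ toℚᵘ-ℤ→ℚ (a ℤ.* b) ⟩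
  mkℚᵘ a 0 ℚᵘ.* mkℚᵘ b 0          ≃⟨ ℚᵘ.≃-sym (ℚᵘ.*-cong (toℚᵘ-ℤ→ℚ a) (toℚᵘ-ℤ→ℚ b)) ⟩
  toℚᵘ (ℤ→ℚ a) ℚᵘ.* toℚᵘ (ℤ→ℚ b)  ≃⟨ ℚᵘ.≃-sym (toℚᵘ-homo-* (ℤ→ℚ a) (ℤ→ℚ b)) ⟩
  toℚᵘ (ℤ→ℚ a ℚ.* ℤ→ℚ b)          ∎)
  where open ℚᵘ.≤-Reasoning

ℤ→ℚ-homo‿- : ∀ a → ℤ→ℚ (ℤ.- a) ≡ - ℤ→ℚ a
ℤ→ℚ-homo‿- a = toℚᵘ-injective (begin-equality
  toℚᵘ (ℤ→ℚ (ℤ.- a))  ≃⟨ toℚᵘ-ℤ→ℚ (ℤ.- a) ⟩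
  ℚᵘ.- mkℚᵘ a 0       ≃⟨ ℚᵘ.≃-sym (ℚᵘ.-‿cong (toℚᵘ-ℤ→ℚ a)) ⟩
  ℚᵘ.- toℚᵘ (ℤ→ℚ a)   ≃⟨ ℚᵘ.≃-sym (toℚᵘ-homo‿- (ℤ→ℚ a)) ⟩
  toℚᵘ (- ℤ→ℚ a)      ∎)
  where open ℚᵘ.≤-Reasoning

ℕ→ℚ-homo-* : ∀ m n → ℕ→ℚ (m * n) ≡ ℕ→ℚ m ℚ.* ℕ→ℚ n
ℕ→ℚ-homo-* m n = trans (cong ℤ→ℚ (ℤ.pos-* m n)) (ℤ→ℚ-homo-* (+ m) (+ n))

ℕ→ℚ-*-inverseʳ : ∀ d .{{_ : NonZero d}} → ℕ→ℚ d ℚ.* (+ 1 / d) ≡ 1ℚ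
ℕ→ℚ-*-inverseʳ (suc d) = toℚᵘ-injective (begin-equality
  toℚᵘ (ℕ→ℚ (suc d) ℚ.* (+ 1 / suc d))          ≃⟨ toℚᵘ-homo-* (ℕ→ℚ (suc d)) (+ 1 / suc d) ⟩
  toℚᵘ (ℕ→ℚ (suc d)) ℚᵘ.* toℚᵘ (+ 1 / suc d)    ≃⟨ ℚᵘ.*-cong (toℚᵘ-fromℚᵘ (mkℚᵘ (+ suc d) 0)) (toℚᵘ-fromℚᵘ (mkℚᵘ (+ 1) d)) ⟩
  mkℚᵘ (+ suc d) 0 ℚᵘ.* ℚᵘ.1/ mkℚᵘ (+ suc d) 0  ≃⟨ ℚᵘ.*-inverseʳ (mkℚᵘ (+ suc d) 0) ⟩
  1ℚᵘ                                           ∎)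
  where open ℚᵘ.≤-Reasoning

isInt-ℕ : ∀ m → IsInt (ℕ→ℚ m)
isInt-ℕ m = + m , refl

isInt-+ : ∀ {p q} → IsInt p → IsInt q → IsInt (p + q)
isInt-+ (a , refl) (b , refl) = a ℤ.+ b , sym (ℤ→ℚ-homo-+ a b)

isInt-* : ∀ {p q} → IsInt p → IsInt q → IsInt (p ℚ.* q)
isInt-* (a , refl) (b , refl) = a ℤ.* b , sym (ℤ→ℚ-homo-* a b)

isInt-neg : ∀ {p} → IsInt p → IsInt (- p)
isInt-neg (a , refl) = ℤ.- a , sym (ℤ→ℚ-homo‿- a)

isInt-- : ∀ {p q} → IsInt p → IsInt q → IsInt (p - q)
isInt-- p q = isInt-+ p (isInt-neg q)

∣⇒isInt-*1/ : ∀ {d m} .{{_ : NonZero d}} → d ∣ m → IsInt (ℕ→ℚ m ℚ.* (+ 1 / d))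
∣⇒isInt-*1/ {d} (divides q refl) = + q , (begin
  ℕ→ℚ (q * d) ℚ.* (+ 1 / d)        ≡⟨ cong (ℚ._* (+ 1 / d)) (ℕ→ℚ-homo-* q d) ⟩
  ℕ→ℚ q ℚ.* ℕ→ℚ d ℚ.* (+ 1 / d)    ≡⟨ *-assoc (ℕ→ℚ q) (ℕ→ℚ d) (+ 1 / d) ⟩
  ℕ→ℚ q ℚ.* (ℕ→ℚ d ℚ.* (+ 1 / d))  ≡⟨ cong (ℕ→ℚ q ℚ.*_) (ℕ→ℚ-*-inverseʳ d) ⟩
  ℕ→ℚ q ℚ.* 1ℚ                     ≡⟨ *-identityʳ (ℕ→ℚ q) ⟩
  ℕ→ℚ q                            ∎)
  where open ≡-Reasoning

lcmUpTo-mono-∣ : ∀ {m n} → m ≤ n → lcmUpTo m ∣ lcmUpTo n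
lcmUpTo-mono-∣ = go ∘ ≤⇒≤′
  where
  go : ∀ {m n} → m ℕ.≤′ n → lcmUpTo m ∣ lcmUpTo n
  go ≤′-refl                     = ∣-refl
  go {n = suc n} (≤′-step m≤′n) = ∣-trans (go m≤′n) (n∣lcm[m,n] (suc n) (lcmUpTo n))

lcmUpTo-*H-isInt : ∀ {L} m → lcmUpTo m ∣ L → IsInt (ℕ→ℚ L ℚ.* H m)
lcmUpTo-*H-isInt {L} zero _ = + 0 , *-zeroʳ (ℕ→ℚ L)
lcmUpTo-*H-isInt {L} (suc m) lcm∣L =
  subst IsInt (sym (*-distribˡ-+ (ℕ→ℚ L) (H m) (+ 1 / suc m)))
    (isInt-+ (lcmUpTo-*H-isInt m (∣-trans (n∣lcm[m,n] (suc m) (lcmUpTo m)) lcm∣L))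
             (∣⇒isInt-*1/ (∣-trans (m∣lcm[m,n] (suc m) (lcmUpTo m)) lcm∣L)))

ℚ-ring : AlmostCommutativeRing 0ℓ 0ℓ
ℚ-ring = fromCommutativeRing +-*-commutativeRing (λ _ → nothing)

L2-coefficient-isInt : ∀ {n k} → k ≤ n →
  IsInt (ℕ→ℚ (n !) ℚ.* (ℕ→ℚ ((n C k) * (n C k)) ℚ.* inv! k))
L2-coefficient-isInt {n} {k} k≤n =
  subst IsInt (swap (ℕ→ℚ (n !)) (ℕ→ℚ ((n C k) * (n C k))) (inv! k))
    (isInt-* (isInt-ℕ ((n C k) * (n C k)))
             (∣⇒isInt-*1/ {{k !≢0}} (m≤n⇒m!∣n! k≤n)))
  where
  swap : ∀ x y z → y ℚ.* (x ℚ.* z) ≡ x ℚ.* (y ℚ.* z)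
  swap = solve-∀ ℚ-ring

L1-coefficient-isInt : ∀ {n k} → k ≤ n →
  IsInt (ℕ→ℚ ((n !) * lcmUpTo n) ℚ.* (ℕ→ℚ ((n C k) * (n C k))
           ℚ.* (ℕ→ℚ 2 ℚ.* H (n ∸ k) - ℕ→ℚ 3 ℚ.* H k) ℚ.* inv! k))
L1-coefficient-isInt {n} {k} k≤n =
  subst IsInt (sym regrouped) (isInt-* (L2-coefficient-isInt k≤n) lcm*harmonic-isInt)
  where
  l c x : ℚ
  l = ℕ→ℚ (lcmUpTo n)
  c = ℕ→ℚ ((n C k) * (n C k))
  x = ℕ→ℚ 2 ℚ.* H (n ∸ k) - ℕ→ℚ 3 ℚ.* H k

  lcm*harmonic-isInt : IsInt (l ℚ.* x)
  lcm*harmonic-isInt =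
    subst IsInt (sym (distrib l (ℕ→ℚ 2) (H (n ∸ k)) (ℕ→ℚ 3) (H k)))
      (isInt-- (isInt-* (isInt-ℕ 2) (lcmUpTo-*H-isInt (n ∸ k) (lcmUpTo-mono-∣ (m∸n≤m n k))))
               (isInt-* (isInt-ℕ 3) (lcmUpTo-*H-isInt k (lcmUpTo-mono-∣ k≤n))))
    where
    distrib : ∀ l t a h b → l ℚ.* (t ℚ.* a - h ℚ.* b) ≡ t ℚ.* (l ℚ.* a) - h ℚ.* (l ℚ.* b)
    distrib = solve-∀ ℚ-ring

  regrouped : ℕ→ℚ ((n !) * lcmUpTo n) ℚ.* (c ℚ.* x ℚ.* inv! k)
            ≡ ℕ→ℚ (n !) ℚ.* (c ℚ.* inv! k) ℚ.* (l ℚ.* x)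
  regrouped = trans (cong (ℚ._* (c ℚ.* x ℚ.* inv! k)) (ℕ→ℚ-homo-* (n !) (lcmUpTo n)))
                    (regroup (ℕ→ℚ (n !)) l c x (inv! k))
    where
    regroup : ∀ f l c x i → f ℚ.* l ℚ.* (c ℚ.* x ℚ.* i) ≡ f ℚ.* (c ℚ.* i) ℚ.* (l ℚ.* x)
    regroup = solve-∀ ℚ-ring

coefficients-isInt : ∀ c {f : ℕ → ℚ} n → (∀ {k} → k ≤ n → IsInt (c ℚ.* f k)) →
                     InZx (c · map f (upTo (suc n)))
coefficients-isInt c n isInt = map⁺ (map⁺ (applyUpTo⁺₁ id (suc n) (isInt ∘ ℕ.s≤s⁻¹)))

proposition2p3 : (n : ℕ) →
    InZx (ℕ→ℚ ((n !) * lcmUpTo n) · L1 n) × InZx (ℕ→ℚ (n !) · L2 n)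
proposition2p3 n =
    coefficients-isInt (ℕ→ℚ ((n !) * lcmUpTo n)) n L1-coefficient-isInt
  , coefficients-isInt (ℕ→ℚ (n !)) n L2-coefficient-isInt
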